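{- Let $\psi = Q_1x_1\dots Q_rx_r\,\theta$ be a first-order sentence with $r$ variables, where $r\ge 3$ and $\theta$ is quantifier-free. If both $\psi$ and $\neg\psi$ are non-replicating sentences, then neither $\psi$ nor $\neg\psi$ contains quantifiers $\exists x_i$, $\forall x_j$, $\exists x_k$ with $i<j<k$ in its quantifier prefix.
   Context: Each $Q_j\in\{\exists,\forall\}$ and $x_1,\dots,x_r$ are distinct. A type over $x_1,\dots,x_r$ is a consistent conjunction of atomic and negated atomic formulas containing, for every atomic formula whose variables are among $x_1,\dots,x_r$ (including equalities $x_i=x_j$, $c=x_j$ with $c$ a constant symbol), exactly one of it or its negation. $\theta$ is written as a disjunction of types, and $\neg\psi$ denotes $\overline{Q_1}x_1\dots\overline{Q_r}x_r\,\theta'$ with dual quantifiers, where $\theta'$ is the disjunction of all consistent types over $x_1,\dots,x_r$ not occurring as disjuncts of $\theta$. For a sentence $\chi=P_1x_1\dots P_rx_r\,\eta$ of this form, a disjunct type $t$ of $\eta$ is non-replicating in $\chi$ if (a) whenever an equality $x_i=x_j$ ($i\neq j$) appears in $t$, either both variables are universally quantified in $\chi$, or one is universally and the other existentially quantified and the existential quantifier precedes the universal one in the prefix; and (b) whenever $c=x_j$ appears in $t$ ($c$ a constant), $x_j$ is universally quantified. $\chi$ is a non-replicating sentence if every disjunct type of $\eta$ is non-replicating in $\chi$. -}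

module Defs where

open import Data.Nat using (ℕ; _<_)
open import Data.Fin using (Fin; toℕ)
open import Data.Vec using (Vec; map)
open import Data.Bool using (Bool; true; false; not)
open import Data.Product using (Σ; ∃; _×_; _,_)
open import Data.Sum using (_⊎_)
open import Relation.Binary.PropositionalEquality using (_≡_; _≢_)
open import Relation.Nullary using (¬_)
open import Level using (0ℓ) renaming (suc to lsuc)

record Signature : Set where
  field
    nR : ℕ
    arity : Fin nR → ℕ
    nC : ℕ
open Signature public

data Quant : Set where
  ∃q ∀q : Quant

dual : Quant → Quant
dual ∃q = ∀q
dual ∀q = ∃q

module _ (σ : Signature) (r : ℕ) where

  data Term : Set where
    var : Fin r → Term
    con : Fin (nC σ) → Term

  data Atom : Set where
    eq  : Term → Term → Atom
    rel : (R : Fin (nR σ)) → Vec Term (arity σ R) → Atom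

  -- a complete choice, for every atomic formula, of it (true) or its negation (false)
  Literals : Set
  Literals = Atom → Bool

  record Interp : Set₁ where
    field
      Dom : Set
      conI : Fin (nC σ) → Dom
      relI : (R : Fin (nR σ)) → Vec Dom (arity σ R) → Bool
      asg : Fin r → Dom

  evalT : (M : Interp) → Term → Interp.Dom M
  evalT M (var i) = Interp.asg M i
  evalT M (con c) = Interp.conI M c

  Holds : Interp → Atom → Set
  Holds M (eq s t) = evalT M s ≡ evalT M t
  Holds M (rel R ts) = Interp.relI M R (map (evalT M) ts) ≡ true

  Consistent : Literals → Set₁
  Consistent t = Σ Interp λ M → (a : Atom) →
    (t a ≡ true → Holds M a) × (t a ≡ false → ¬ Holds M a)

  -- A sentence  Q_1 x_1 ... Q_r x_r θ  is given by its prefix Q and by the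
  -- set of types occurring as disjuncts of θ, given as a Boolean predicate
  -- on complete literal sets (only its values on consistent ones matter).
  Prefix : Set
  Prefix = Fin r → Quant

  Matrix : Set
  Matrix = Literals → Bool

  -- the matrix θ' of ¬ψ: all consistent types not occurring in θ
  negMatrix : Matrix → Matrix
  negMatrix θ t = not (θ t)

  negPrefix : Prefix → Prefix
  negPrefix Q i = dual (Q i)

  EqOK : Prefix → Fin r → Fin r → Set
  EqOK Q i j =
      (Q i ≡ ∀q × Q j ≡ ∀q)
    ⊎ (Q i ≡ ∃q × Q j ≡ ∀q × toℕ i < toℕ j)
    ⊎ (Q i ≡ ∀q × Q j ≡ ∃q × toℕ j < toℕ i)

  NonReplicatingType : Prefix → Literals → Set
  NonReplicatingType Q t =
    ((i j : Fin r) → i ≢ j → t (eq (var i) (var j)) ≡ true → EqOK Q i j)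
    × ((c : Fin (nC σ)) (j : Fin r) → t (eq (con c) (var j)) ≡ true → Q j ≡ ∀q)

  NonReplicating : Prefix → Matrix → Set₁
  NonReplicating Q θ = (t : Literals) → Consistent t → θ t ≡ true →
    NonReplicatingType Q t

  HasEAE : Prefix → Set
  HasEAE Q = Σ (Fin r) λ i → Σ (Fin r) λ j → Σ (Fin r) λ k →
    toℕ i < toℕ j × toℕ j < toℕ k × Q i ≡ ∃q × Q j ≡ ∀q × Q k ≡ ∃q

{-# OPTIONS --safe #-}
-- The type in which every atomic formula holds is realized by a one-point
-- structure, so it is a disjunct of θ or of θ'. It contains every equality
-- x_i = x_j, hence the prefix of ψ or of ¬ψ admits all of them. That fails as
-- soon as the prefix has two existential variables, or a universal variable
-- before an existential one; an ∃x_i ∀x_j ∃x_k pattern in either prefix produces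
-- the first defect in that prefix and the second in its dual.
module Submission where

open import Defs
open import Data.Nat using (ℕ; _≤_; _<_)
open import Data.Nat.Properties using (<-asym; <-trans)
open import Data.Product using (_×_; _,_; proj₁; proj₂)
open import Data.Sum using (_⊎_; inj₁; inj₂)
open import Data.Bool using (true; false; not)
open import Data.Unit using (⊤; tt)
open import Data.Fin using (Fin; toℕ)
open import Data.Fin.Properties using (<⇒≢)
open import Relation.Nullary using (¬_)
open import Relation.Binary.PropositionalEquality using (_≡_; _≢_; refl; cong)

≡∃⇒≢∀ : ∀ {q} → q ≡ ∃q → q ≢ ∀q
≡∃⇒≢∀ refl ()

dual≡∃⇒≡∀ : ∀ {q} → dual q ≡ ∃q → q ≡ ∀q
dual≡∃⇒≡∀ {∀q} _ = refl

dual≡∀⇒≡∃ : ∀ {q} → dual q ≡ ∀q → q ≡ ∃q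
dual≡∀⇒≡∃ {∃q} _ = refl

module _ (σ : Signature) (r : ℕ) where

  AllEqOK : Prefix σ r → Set
  AllEqOK P = (i j : Fin r) → i ≢ j → EqOK σ r P i j

  ∃∃⇒¬EqOK : (P : Prefix σ r) {i k : Fin r} →
    P i ≡ ∃q → P k ≡ ∃q → ¬ EqOK σ r P i k
  ∃∃⇒¬EqOK P Pi Pk (inj₁ (Pi≡∀ , _))          = ≡∃⇒≢∀ Pi Pi≡∀
  ∃∃⇒¬EqOK P Pi Pk (inj₂ (inj₁ (_ , Pk≡∀ , _))) = ≡∃⇒≢∀ Pk Pk≡∀
  ∃∃⇒¬EqOK P Pi Pk (inj₂ (inj₂ (Pi≡∀ , _)))     = ≡∃⇒≢∀ Pi Pi≡∀

  ∀<∃⇒¬EqOK : (P : Prefix σ r) {i j : Fin r} →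
    P i ≡ ∀q → P j ≡ ∃q → toℕ i < toℕ j → ¬ EqOK σ r P i j
  ∀<∃⇒¬EqOK P Pi Pj i<j (inj₁ (_ , Pj≡∀))           = ≡∃⇒≢∀ Pj Pj≡∀
  ∀<∃⇒¬EqOK P Pi Pj i<j (inj₂ (inj₁ (Pi≡∃ , _)))    = ≡∃⇒≢∀ Pi≡∃ Pi
  ∀<∃⇒¬EqOK P Pi Pj i<j (inj₂ (inj₂ (_ , _ , j<i))) = <-asym i<j j<i

  ∃∃⇒¬AllEqOK : (P : Prefix σ r) {i k : Fin r} → toℕ i < toℕ k →
    P i ≡ ∃q → P k ≡ ∃q → ¬ AllEqOK P
  ∃∃⇒¬AllEqOK P i<k Pi Pk ok = ∃∃⇒¬EqOK P Pi Pk (ok _ _ (<⇒≢ i<k))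

  ∀<∃⇒¬AllEqOK : (P : Prefix σ r) {i j : Fin r} → toℕ i < toℕ j →
    P i ≡ ∀q → P j ≡ ∃q → ¬ AllEqOK P
  ∀<∃⇒¬AllEqOK P i<j Pi Pj ok = ∀<∃⇒¬EqOK P Pi Pj i<j (ok _ _ (<⇒≢ i<j))

  allTrue : Literals σ r
  allTrue _ = true

  allTrue-consistent : Consistent σ r allTrue
  allTrue-consistent = point , realizes
    where
    point : Interp σ r
    point = record { Dom = ⊤ ; conI = λ _ → tt ; relI = λ _ _ → true ; asg = λ _ → tt }

    realizes : (a : Atom σ r) →
      (allTrue a ≡ true → Holds σ r point a) × (allTrue a ≡ false → ¬ Holds σ r point a)
    realizes (eq s t)   = (λ _ → refl) , λ ()
    realizes (rel R ts) = (λ _ → refl) , λ ()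

  NonReplicating-allTrue⇒AllEqOK : (P : Prefix σ r) (θ : Matrix σ r) →
    NonReplicating σ r P θ → θ allTrue ≡ true → AllEqOK P
  NonReplicating-allTrue⇒AllEqOK P θ nr θ∋allTrue i j i≢j =
    proj₁ (nr allTrue allTrue-consistent θ∋allTrue) i j i≢j refl

  AllEqOK-or-negPrefix : (Q : Prefix σ r) (θ : Matrix σ r) →
    NonReplicating σ r Q θ →
    NonReplicating σ r (negPrefix σ r Q) (negMatrix σ r θ) →
    AllEqOK Q ⊎ AllEqOK (negPrefix σ r Q)
  AllEqOK-or-negPrefix Q θ nr nr¬ with θ allTrue in θ-allTrue
  ... | true  = inj₁ (NonReplicating-allTrue⇒AllEqOK Q θ nr θ-allTrue)
  ... | false = inj₂ (NonReplicating-allTrue⇒AllEqOK (negPrefix σ r Q) (negMatrix σ r θ)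
                        nr¬ (cong not θ-allTrue))

  HasEAE⇒¬AllEqOK : (Q : Prefix σ r) → HasEAE σ r Q →
    ¬ AllEqOK Q × ¬ AllEqOK (negPrefix σ r Q)
  HasEAE⇒¬AllEqOK Q (i , j , k , i<j , j<k , Qi , Qj , Qk) =
      ∃∃⇒¬AllEqOK Q (<-trans i<j j<k) Qi Qk
    , ∀<∃⇒¬AllEqOK (negPrefix σ r Q) i<j (cong dual Qi) (cong dual Qj)

  HasEAE-negPrefix⇒¬AllEqOK : (Q : Prefix σ r) → HasEAE σ r (negPrefix σ r Q) →
    ¬ AllEqOK Q × ¬ AllEqOK (negPrefix σ r Q)
  HasEAE-negPrefix⇒¬AllEqOK Q eae@(i , j , _ , i<j , _ , ¬Qi , ¬Qj , _) =
      ∀<∃⇒¬AllEqOK Q i<j (dual≡∃⇒≡∀ ¬Qi) (dual≡∀⇒≡∃ ¬Qj)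
    , proj₁ (HasEAE⇒¬AllEqOK (negPrefix σ r Q) eae)

proposition4p11 : (σ : Signature) (r : ℕ) → 3 ≤ r →
    (Q : Prefix σ r) (θ : Matrix σ r) →
    NonReplicating σ r Q θ →
    NonReplicating σ r (negPrefix σ r Q) (negMatrix σ r θ) →
    ¬ HasEAE σ r Q × ¬ HasEAE σ r (negPrefix σ r Q)
proposition4p11 σ r _ Q θ nr nr¬ = refute (HasEAE⇒¬AllEqOK σ r Q)
                                 , refute (HasEAE-negPrefix⇒¬AllEqOK σ r Q)
  where
  refute : ∀ {E : Set} → (E → ¬ AllEqOK σ r Q × ¬ AllEqOK σ r (negPrefix σ r Q)) → ¬ E
  refute blocks e with AllEqOK-or-negPrefix σ r Q θ nr nr¬
  ... | inj₁ ok  = proj₁ (blocks e) ok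
  ... | inj₂ ok¬ = proj₂ (blocks e) ok¬
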